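{- None of the following three properties holds: (strong finite model property) every $\mathcal L$-formula falsifiable on some bi-relational model is falsifiable on a bi-relational model $(W,T,\le,S,[\![\cdot]\!])$ with both $W$ and $T$ finite; (order finite model property) the same with only $W$ required finite; (temporal finite model property) the same with only $T$ required finite. In particular, the formula $\mathsf F(p\Rightarrow\mathsf Xp)$ (for $p\in\mathbb P$) is falsifiable on some bi-relational model, yet it is globally true on every bi-relational model in which $W$ and $T$ are both finite.
   Context: Fix a countably infinite set $\mathbb P$ of propositional variables. The language $\mathcal L$ is given by $\varphi,\psi ::= p \mid \varphi\wedge\psi\mid\varphi\vee\psi\mid\varphi\Rightarrow\psi\mid\varphi\Leftarrow\psi\mid \mathsf X\varphi\mid\mathsf Y\varphi\mid\mathsf G\varphi\mid\mathsf H\varphi\mid\varphi\,\mathsf U\,\psi\mid\varphi\,\mathsf S\,\psi$ with $p\in\mathbb P$. Abbreviations: $\top:=q\Rightarrow q$ for a fixed variable $q$, and $\mathsf F\varphi:=\top\,\mathsf U\,\varphi$. A flow is $(T,S)$ with $S:T\to T$ a bijection. A bi-relational model is $(W,T,\le,S,[\![\cdot]\!])$ where $(W,\le)$ is a linear order, $(T,S)$ a flow, writing $\vec S(w,t)=(w,S(t))$, and $[\![\cdot]\!]:\mathcal L\to 2^{W\times T}$ is such that each $[\![p]\!]$ is downward closed in the first coordinate and: $[\![\varphi\wedge\psi]\!]=[\![\varphi]\!]\cap[\![\psi]\!]$; $[\![\varphi\vee\psi]\!]=[\![\varphi]\!]\cup[\![\psi]\!]$; $(w,t)\in[\![\varphi\Rightarrow\psi]\!]$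 iff for all $v\le w$, $(v,t)\in[\![\varphi]\!]$ implies $(v,t)\in[\![\psi]\!]$; $(w,t)\in[\![\varphi\Leftarrow\psi]\!]$ iff there is $v\ge w$ with $(v,t)\in[\![\varphi]\!]\setminus[\![\psi]\!]$; $[\![\mathsf X\varphi]\!]=\vec S^{ -1}[\![\varphi]\!]$; $[\![\mathsf Y\varphi]\!]=\vec S[\![\varphi]\!]$; $[\![\mathsf G\varphi]\!]=\bigcap_{n\ge0}\vec S^{ -n}[\![\varphi]\!]$; $[\![\mathsf H\varphi]\!]=\bigcap_{n\ge0}\vec S^{n}[\![\varphi]\!]$; $[\![\varphi\,\mathsf U\,\psi]\!]=\bigcup_{n\ge0}(\vec S^0[\![\varphi]\!]\cap\dots\cap\vec S^{ -(n-1)}[\![\varphi]\!]\cap\vec S^{ -n}[\![\psi]\!])$; $[\![\varphi\,\mathsf S\,\psi]\!]=\bigcup_{n\ge0}(\vec S^0[\![\varphi]\!]\cap\dots\cap\vec S^{n-1}[\![\varphi]\!]\cap\vec S^{n}[\![\psi]\!])$. A formula $\varphi$ is globally true on the model if $[\![\varphi]\!]=W\times T$, and falsifiable on it otherwise. -}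

module Defs where

open import Level using (0ℓ)
open import Data.Nat using (ℕ; zero; suc; _<_)
open import Data.Bool using (Bool; true)
open import Data.Fin using (Fin)
open import Data.Product using (Σ; ∃; ∃-syntax; _×_; _,_)
open import Data.Sum using (_⊎_)
open import Relation.Nullary using (¬_)
open import Relation.Binary using (Rel; IsTotalOrder)
open import Relation.Binary.PropositionalEquality using (_≡_)
open import Function.Definitions using (Bijective)
open import Function.Bundles using (_↔_)

infixr 6 _∧_
infixr 5 _∨_
infixr 4 _⇒_ _⇐_
data Form : Set where
  var : ℕ → Form
  _∧_ _∨_ _⇒_ _⇐_ : Form → Form → Form
  X Y G H : Form → Form
  _U_ _S_ : Form → Form → Form

⊤f : Form
⊤f = var 0 ⇒ var 0

F : Form → Form
F φ = ⊤f U φ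

iter : {A : Set} → ℕ → (A → A) → A → A
iter zero    f a = a
iter (suc n) f a = f (iter n f a)

record BiModel : Set₁ where
  field
    W T     : Set
    _≤_     : Rel W 0ℓ
    linear  : IsTotalOrder _≡_ _≤_
    Sf      : T → T
    Sf-bij  : Bijective _≡_ _≡_ Sf
    V       : ℕ → W → T → Bool
    V-down  : ∀ p {v w} t → v ≤ w → V p w t ≡ true → V p v t ≡ true

module _ (M : BiModel) where
  open BiModel M

  InImg : ℕ → (W → T → Set) → W → T → Set
  InImg n A w t = ∃[ s ] (iter n Sf s ≡ t × A w s)

  Sat : Form → W → T → Set
  Sat (var p) w t = V p w t ≡ true
  Sat (φ ∧ ψ) w t = Sat φ w t × Sat ψ w t
  Sat (φ ∨ ψ) w t = Sat φ w t ⊎ Sat ψ w t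
  Sat (φ ⇒ ψ) w t = ∀ v → v ≤ w → Sat φ v t → Sat ψ v t
  Sat (φ ⇐ ψ) w t = ∃[ v ] (w ≤ v × Sat φ v t × ¬ Sat ψ v t)
  Sat (X φ) w t = Sat φ w (Sf t)
  Sat (Y φ) w t = InImg 1 (Sat φ) w t
  Sat (G φ) w t = ∀ n → Sat φ w (iter n Sf t)
  Sat (H φ) w t = ∀ n → InImg n (Sat φ) w t
  Sat (φ U ψ) w t =
    ∃[ n ] ((∀ k → k < n → Sat φ w (iter k Sf t)) × Sat ψ w (iter n Sf t))
  Sat (φ S ψ) w t =
    ∃[ n ] ((∀ k → k < n → InImg k (Sat φ) w t) × InImg n (Sat ψ) w t)

  GloballyTrue : Form → Set
  GloballyTrue φ = ∀ w t → Sat φ w t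

  Falsifiable : Form → Set
  Falsifiable φ = ∃[ w ] ∃[ t ] (¬ Sat φ w t)

Finite : Set → Set
Finite A = ∃[ n ] (A ↔ Fin n)

StrongFMP : Set₁
StrongFMP = ∀ φ → (∃[ M ] Falsifiable M φ) →
  ∃[ M ] (Finite (BiModel.W M) × Finite (BiModel.T M) × Falsifiable M φ)

OrderFMP : Set₁
OrderFMP = ∀ φ → (∃[ M ] Falsifiable M φ) →
  ∃[ M ] (Finite (BiModel.W M) × Falsifiable M φ)

TemporalFMP : Set₁
TemporalFMP = ∀ φ → (∃[ M ] Falsifiable M φ) →
  ∃[ M ] (Finite (BiModel.T M) × Falsifiable M φ)

-- Fix t and let Dₘ be the set of worlds where p holds at time Sᵐ t.  The Dₘ are
-- downsets of the linear order W, hence pairwise nested, and F (p ⇒ X p) holds at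
-- (w , t) as soon as some Dₘ ⊆ Dₘ₊₁.  If W is finite, every failing step shrinks
-- the chain strictly, which cannot go on forever.  If F (p ⇒ X p) fails at (w , t),
-- every step fails below w, so by nestedness Dₘ₊₁ ⊆ Dₘ for all m; if T is finite the orbit
-- of t repeats, and the chain returns to a set it has strictly left.  On ℤ × ℤ with
-- W ordered reversely and p true at (w , t) iff t ≤ w, the formula fails at
-- (0 , 0): at time n the world n satisfies p, but no longer at time n + 1.
module Submission where

open import Defs
open import Level using (0ℓ)
open import Data.Bool using (Bool; true; false)
open import Data.Bool.Properties using (T-≡; ¬-not; not-¬)
open import Data.Empty using (⊥-elim)
open import Data.Fin using (Fin; toℕ)
open import Data.Fin.Properties using (pigeonhole)
open import Data.Fin.Subset using (Subset; _∈_; _⊆_; _⊂_; ∣_∣)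
open import Data.Fin.Subset.Properties using (_⊂?_; p⊂q⇒∣p∣<∣q∣)
open import Data.Integer.Base as ℤ using (ℤ; +_; _≤ᵇ_)
import Data.Integer.Properties as ℤₚ
open import Data.Nat.Base as ℕ using (ℕ; zero; suc; _<_; _≤′_; ≤′-refl; ≤′-step; z≤n; s≤s⁻¹)
import Data.Nat.Properties as ℕₚ
open import Data.Product using (∃; ∃-syntax; ∃₂; _×_; _,_)
open import Data.Sum using (_⊎_; inj₁; inj₂)
open import Data.Vec using (tabulate)
open import Data.Vec.Properties using (lookup∘tabulate; lookup⇒[]=; []=⇒lookup)
open import Function using (_∘_; flip)
open import Function.Definitions using (Bijective)
open import Function.Bundles using (Inverse; Injection; Equivalence; _↔_)
open import Function.Consequences using (inverseᵇ⇒bijective)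
open import Function.Consequences.Propositional
  using (strictlyInverseˡ⇒inverseˡ; strictlyInverseʳ⇒inverseʳ)
open import Function.Properties.Inverse using (↔⇒↣)
open import Relation.Binary using (Rel; Total; IsTotalOrder)
import Relation.Binary.Construct.Flip.EqAndOrd as Flip
open import Relation.Binary.PropositionalEquality
  using (_≡_; refl; sym; trans; cong; subst)
open import Relation.Nullary using (¬_; yes; no)

descent-halts : {P : ℕ → Set} (c : ℕ → ℕ) → (∀ m → P m ⊎ c (suc m) < c m) → ∃ P
descent-halts {P} c step = go (c 0) 0 ℕₚ.≤-refl
  where
  go : ∀ k m → c m ℕ.≤ k → ∃ P
  go k m cₘ≤k with step m
  ... | inj₁ Pₘ = m , Pₘ
  go zero    m cₘ≤0   | inj₂ shrinks = ⊥-elim (ℕₚ.n≮0 (ℕₚ.<-≤-trans shrinks cₘ≤0))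
  go (suc k) m cₘ≤1+k | inj₂ shrinks = go k (suc m) (s≤s⁻¹ (ℕₚ.<-≤-trans shrinks cₘ≤1+k))

orbit-repeats : {T : Set} → Finite T → (f : T → T) (t : T) →
  ∃₂ λ a b → a < b × iter a f t ≡ iter b f t
orbit-repeats (N , T↔Fin) f t
  with i , j , i<j , eq ← pigeonhole (ℕₚ.n<1+n N) (Inverse.to T↔Fin ∘ (λ n → iter n f t) ∘ toℕ)
  = toℕ i , toℕ j , i<j , Injection.injective (↔⇒↣ T↔Fin) eq

infix 4 _⊆ᵇ_

_⊆ᵇ_ : {W : Set} → (W → Bool) → (W → Bool) → Set
A ⊆ᵇ B = ∀ v → A v ≡ true → B v ≡ true

antitone-≤′ : {W : Set} {D : ℕ → W → Bool} → (∀ m → D (suc m) ⊆ᵇ D m) →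
  ∀ {m n} → m ≤′ n → D n ⊆ᵇ D m
antitone-≤′ shrinks ≤′-refl          = λ _ Dv → Dv
antitone-≤′ shrinks (≤′-step {n} m≤n) = λ v Dv → antitone-≤′ shrinks m≤n v (shrinks n v Dv)

IsDownset : {W : Set} → Rel W 0ℓ → (W → Bool) → Set
IsDownset _≤_ A = ∀ {u v} → u ≤ v → A v ≡ true → A u ≡ true

module _ {W : Set} {_≤_ : Rel W 0ℓ} (total : Total _≤_) where

  ⊈⇒⊇ : {A B : W → Bool} → IsDownset _≤_ A → IsDownset _≤_ B →
    ∀ u → A u ≡ true → B u ≡ false → B ⊆ᵇ A
  ⊈⇒⊇ A↓ B↓ u Au Bu v Bv with total u v
  ... | inj₁ u≤v = ⊥-elim (not-¬ Bu (B↓ u≤v Bv))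
  ... | inj₂ v≤u = A↓ v≤u Au

  ¬⊆⇒⊇ : {A B : W → Bool} → IsDownset _≤_ A → IsDownset _≤_ B →
    ¬ (A ⊆ᵇ B) → B ⊆ᵇ A
  ¬⊆⇒⊇ A↓ B↓ A⊈B v Bv = ¬-not λ Av → A⊈B (⊈⇒⊇ B↓ A↓ v Bv Av)

module _ {W : Set} {N : ℕ} (W↔Fin : W ↔ Fin N) where
  open Inverse W↔Fin using (to; from; strictlyInverseʳ)

  ⌊_⌋ : (W → Bool) → Subset N
  ⌊ A ⌋ = tabulate (A ∘ from)

  ∈⌊⌋⁺ : ∀ {A i} → A (from i) ≡ true → i ∈ ⌊ A ⌋
  ∈⌊⌋⁺ {A} {i} Aᵢ = lookup⇒[]= i ⌊ A ⌋ (trans (lookup∘tabulate (A ∘ from) i) Aᵢ)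

  ∈⌊⌋⁻ : ∀ {A i} → i ∈ ⌊ A ⌋ → A (from i) ≡ true
  ∈⌊⌋⁻ {A} {i} i∈A = trans (sym (lookup∘tabulate (A ∘ from) i)) ([]=⇒lookup i∈A)

  to∈⌊⌋⁺ : ∀ {A v} → A v ≡ true → to v ∈ ⌊ A ⌋
  to∈⌊⌋⁺ {A} {v} Av = ∈⌊⌋⁺ {A} (subst (λ u → A u ≡ true) (sym (strictlyInverseʳ v)) Av)

  to∈⌊⌋⁻ : ∀ {A v} → to v ∈ ⌊ A ⌋ → A v ≡ true
  to∈⌊⌋⁻ {A} {v} v∈A = subst (λ u → A u ≡ true) (strictlyInverseʳ v) (∈⌊⌋⁻ {A} v∈A)

  ⌊⌋-mono : ∀ {A B} → A ⊆ᵇ B → ⌊ A ⌋ ⊆ ⌊ B ⌋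
  ⌊⌋-mono {A} {B} A⊆B i∈A = ∈⌊⌋⁺ {B} (A⊆B _ (∈⌊⌋⁻ {A} i∈A))

  -- A failed decision of ⌊ A ⌋ ⊆ ⌊ B ⌋ would yield no witness; a failed decision
  -- of the strict inclusion ⌊ B ⌋ ⊂ ⌊ A ⌋ is instead refuted pointwise.
  ⊆-or-⌊⌋-shrinks : {_≤_ : Rel W 0ℓ} → Total _≤_ → {A B : W → Bool} →
    IsDownset _≤_ A → IsDownset _≤_ B → A ⊆ᵇ B ⊎ ∣ ⌊ B ⌋ ∣ < ∣ ⌊ A ⌋ ∣
  ⊆-or-⌊⌋-shrinks total {A} {B} A↓ B↓ with ⌊ B ⌋ ⊂? ⌊ A ⌋
  ... | yes B⊂A = inj₂ (p⊂q⇒∣p∣<∣q∣ B⊂A)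
  ... | no  B⊄A = inj₁ λ v Av → ¬-not λ Bv → B⊄A (⌊B⌋⊂⌊A⌋ v Av Bv)
    where
    ⌊B⌋⊂⌊A⌋ : ∀ u → A u ≡ true → B u ≡ false → ⌊ B ⌋ ⊂ ⌊ A ⌋
    ⌊B⌋⊂⌊A⌋ u Au Bu =
      ⌊⌋-mono (⊈⇒⊇ total A↓ B↓ u Au Bu) , to u , to∈⌊⌋⁺ {A} Au ,
      not-¬ Bu ∘ to∈⌊⌋⁻ {B}

module _ (M : BiModel) where
  open BiModel M
  open IsTotalOrder linear using (total)

  sections : ℕ → T → ℕ → W → Bool
  sections p t m v = V p v (iter m Sf t)

  sections↓ : ∀ p t m → IsDownset _≤_ (sections p t m)
  sections↓ p t m = V-down p (iter m Sf t)

  F[p⇒Xp]-intro : ∀ {p w t} n → sections p t n ⊆ᵇ sections p t (suc n) →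
    Sat M (F (var p ⇒ X (var p))) w t
  F[p⇒Xp]-intro n Dₙ⊆Dₙ₊₁ = n , (λ _ _ _ _ ⊤ᵥ → ⊤ᵥ) , λ v _ → Dₙ⊆Dₙ₊₁ v

  finiteW⇒globallyTrue : Finite W → ∀ p → GloballyTrue M (F (var p ⇒ X (var p)))
  finiteW⇒globallyTrue (N , W↔Fin) p w t
    with n , Dₙ⊆Dₙ₊₁ ← descent-halts (λ m → ∣ ⌊ W↔Fin ⌋ (sections p t m) ∣) (λ m →
           ⊆-or-⌊⌋-shrinks W↔Fin total (sections↓ p t m) (sections↓ p t (suc m)))
    = F[p⇒Xp]-intro n Dₙ⊆Dₙ₊₁

  finiteW⇒¬falsifiable : Finite W → ∀ p → ¬ Falsifiable M (F (var p ⇒ X (var p)))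
  finiteW⇒¬falsifiable finW p (w , t , ¬Fφ) = ¬Fφ (finiteW⇒globallyTrue finW p w t)

  finiteT⇒¬falsifiable : Finite T → ∀ p → ¬ Falsifiable M (F (var p ⇒ X (var p)))
  finiteT⇒¬falsifiable finT p (w , t , ¬Fφ)
    with a , b , a<b , Sᵃt≡Sᵇt ← orbit-repeats finT Sf t
    = ¬Fφ (F[p⇒Xp]-intro a λ v Dₐv →
        antitone-≤′ shrinks (ℕₚ.≤⇒≤′ a<b) v (subst (λ s → V p v s ≡ true) Sᵃt≡Sᵇt Dₐv))
    where
    shrinks : ∀ m → sections p t (suc m) ⊆ᵇ sections p t m
    shrinks m = ¬⊆⇒⊇ total (sections↓ p t m) (sections↓ p t (suc m)) λ Dₘ⊆Dₘ₊₁ →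
      ¬Fφ (F[p⇒Xp]-intro m Dₘ⊆Dₘ₊₁)

ℤ-suc-bijective : Bijective _≡_ _≡_ ℤ.suc
ℤ-suc-bijective = inverseᵇ⇒bijective _≡_ refl sym trans
  ( strictlyInverseˡ⇒inverseˡ {f⁻¹ = ℤ.pred} ℤ.suc ℤₚ.suc-pred
  , strictlyInverseʳ⇒inverseʳ ℤ.suc ℤₚ.pred-suc )

≤ᵇ≡true⇒≤ : ∀ {i j} → (i ≤ᵇ j) ≡ true → i ℤ.≤ j
≤ᵇ≡true⇒≤ = ℤₚ.≤ᵇ⇒≤ ∘ Equivalence.from T-≡

≤⇒≤ᵇ≡true : ∀ {i j} → i ℤ.≤ j → (i ≤ᵇ j) ≡ true
≤⇒≤ᵇ≡true = Equivalence.to T-≡ ∘ ℤₚ.≤⇒≤ᵇ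

≤ᵇ-model : BiModel
≤ᵇ-model = record
  { W      = ℤ
  ; T      = ℤ
  ; _≤_    = flip ℤ._≤_
  ; linear = Flip.isTotalOrder ℤₚ.≤-isTotalOrder
  ; Sf     = ℤ.suc
  ; Sf-bij = ℤ-suc-bijective
  ; V      = λ _ w t → t ≤ᵇ w
  ; V-down = λ _ {v} {w} t w≤v t≤w → ≤⇒≤ᵇ≡true (ℤₚ.≤-trans (≤ᵇ≡true⇒≤ {t} {w} t≤w) w≤v)
  }

iter-suc-0 : ∀ n → iter n ℤ.suc (+ 0) ≡ + n
iter-suc-0 zero    = refl
iter-suc-0 (suc n) = cong ℤ.suc (iter-suc-0 n)

≤ᵇ-model-falsifies : ∀ p → Falsifiable ≤ᵇ-model (F (var p ⇒ X (var p)))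
≤ᵇ-model-falsifies p = + 0 , + 0 , λ (n , _ , persists) →
  ¬persists n _ (iter-suc-0 n) persists
  where
  ¬persists : ∀ n s → s ≡ + n → ¬ Sat ≤ᵇ-model (var p ⇒ X (var p)) (+ 0) s
  ¬persists n _ refl persists = ℤₚ.<-irrefl refl (ℤₚ.suc[i]≤j⇒i<j n+1≤n)
    where
    n+1≤n : ℤ.suc (+ n) ℤ.≤ + n
    n+1≤n = ≤ᵇ≡true⇒≤ (persists (+ n) (ℤ.+≤+ z≤n) (≤⇒≤ᵇ≡true {+ n} ℤₚ.≤-refl))

proposition4p2 : ¬ StrongFMP × ¬ OrderFMP × ¬ TemporalFMP
    × (∀ (p : ℕ) →
        (∃[ M ] Falsifiable M (F (var p ⇒ X (var p))))
        × (∀ M → Finite (BiModel.W M) → Finite (BiModel.T M) →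
             GloballyTrue M (F (var p ⇒ X (var p)))))
proposition4p2 =
    (λ strong → let M , finW , _ , fals = strong φ falsifiable
                in finiteW⇒¬falsifiable M finW 0 fals)
  , (λ order → let M , finW , fals = order φ falsifiable
               in finiteW⇒¬falsifiable M finW 0 fals)
  , (λ temporal → let M , finT , fals = temporal φ falsifiable
                  in finiteT⇒¬falsifiable M finT 0 fals)
  , λ p → (≤ᵇ-model , ≤ᵇ-model-falsifies p) , λ M finW _ → finiteW⇒globallyTrue M finW p
  where
  φ : Form
  φ = F (var 0 ⇒ X (var 0))

  falsifiable : ∃[ M ] Falsifiable M φ
  falsifiable = ≤ᵇ-model , ≤ᵇ-model-falsifies 0
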